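{- Let $m\equiv 1\pmod 4$, $m\geq 5$, and let $M$ be an induced matching of the grid $G_{3,m}$. Suppose that for some $j$ with $1\leq j$ and $j+3\leq m$, both the edge joining $u_1v_j$ and $u_2v_j$ and the edge joining $u_1v_{j+3}$ and $u_2v_{j+3}$ belong to $M$. Then $|M|\neq \mathrm{Max}(G_{3,m})$.
   Context: For integers $n,m\geq 2$, the grid $G_{n,m}$ is the Cartesian product of the path $P_n=u_1u_2\cdots u_n$ and the path $P_m=v_1v_2\cdots v_m$; its vertices are written $u_iv_j$ ($1\le i\le n$, $1\le j\le m$), and $u_iv_j$, $u_kv_l$ are adjacent iff either $i=k$ and $|j-l|=1$, or $j=l$ and $|i-k|=1$. An induced matching of a graph $G$ is a set $M$ of pairwise vertex-disjoint edges such that no edge of $G$ joins endpoints of two distinct edges of $M$. $\mathrm{Max}(G)$ denotes the maximum size of an induced matching of $G$. -}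

module Defs where

open import Data.Nat using (ℕ; suc; _≤_; _+_)
open import Data.Fin using (Fin; toℕ)
open import Data.Product using (_×_; _,_; proj₁; proj₂; ∃-syntax)
open import Data.Sum using (_⊎_)
open import Data.Empty using (⊥)
open import Data.List using (List; length; lookup)
open import Relation.Binary.PropositionalEquality using (_≡_; _≢_)

-- Vertex u_i v_j of G_{n,m} is (i , j) with 0-based indices i : Fin n, j : Fin m.
Vertex : ℕ → ℕ → Set
Vertex n m = Fin n × Fin m

Adj1 : ℕ → ℕ → Set
Adj1 a b = (suc a ≡ b) ⊎ (suc b ≡ a)

GridAdj : (n m : ℕ) → Vertex n m → Vertex n m → Set
GridAdj n m (i , j) (k , l) =
  (i ≡ k × Adj1 (toℕ j) (toℕ l)) ⊎ (j ≡ l × Adj1 (toℕ i) (toℕ k))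

Edge : ℕ → ℕ → Set
Edge n m = Vertex n m × Vertex n m

Ends : {n m : ℕ} → Edge n m → Vertex n m → Set
Ends (a , b) x = (x ≡ a) ⊎ (x ≡ b)

-- An induced matching: a list of edges of the grid, such that for any two
-- distinct positions the edges share no vertex and no grid edge joins an
-- endpoint of one to an endpoint of the other.  (Vertex-disjointness of
-- distinct positions also rules out repeated edges, so length = |M|.)
record IsInducedMatching (n m : ℕ) (M : List (Edge n m)) : Set where
  field
    isEdge   : ∀ p → GridAdj n m (proj₁ (lookup M p)) (proj₂ (lookup M p))
    disjoint : ∀ p q → p ≢ q → ∀ x →
               Ends (lookup M p) x → Ends (lookup M q) x → ⊥
    induced  : ∀ p q → p ≢ q → ∀ x y →
               Ends (lookup M p) x → Ends (lookup M q) y → GridAdj n m x y → ⊥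

IsMaxInducedMatchingSize : (n m k : ℕ) → Set
IsMaxInducedMatchingSize n m k =
  (∃[ M ] (IsInducedMatching n m M × length M ≡ k)) ×
  (∀ M → IsInducedMatching n m M → length M ≤ k)

ContainsEdge : {n m : ℕ} → List (Edge n m) → Vertex n m → Vertex n m → Set
ContainsEdge M a b = ∃[ p ] ((lookup M p ≡ (a , b)) ⊎ (lookup M p ≡ (b , a)))

-- Label every vertex by the direction of its partner in M (N if unmatched). Column by
-- column, the labels form one of thirteen local states, consecutive columns obey local
-- compatibility conditions, and |M| counts the labels D and R. A potential on pairs
-- (state, phase), where the phase records the position relative to the forced columns c and
-- c + 3, drops by at least 4 · weight − 3 per column; hence 4 |M| ≤ 3m. For m = 4k + 5 this
-- leaves |M| ≤ 3k + 3, whereas repeating a four-column pattern (top and bottom rows, then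
-- the middle row) gives an induced matching with 3k + 4 edges.
module Submission where

open import Defs
open import Data.Bool using (Bool; true; false; T; not; _∧_; _∨_; _xor_; if_then_else_)
open import Data.Bool.ListAction using (all)
open import Data.Bool.Properties using (∨-zeroʳ)
open import Data.Empty using (⊥; ⊥-elim)
open import Data.Fin using (Fin; fromℕ<; zero; suc; toℕ; _↑ʳ_)
open import Data.Fin.Patterns using (0F; 1F; 2F; 3F; 4F)
open import Data.Fin.Properties using (toℕ-injective; toℕ<n; toℕ-fromℕ<; toℕ-↑ʳ; ↑ʳ-injective)
import Data.Fin.Properties as Fin
open import Data.List using (List; []; _∷_; _++_; length; lookup; map; filterᵇ; cartesianProduct)
open import Data.List.Membership.Propositional using (_∈_)
open import Data.List.Membership.Propositional.Properties
  using (∈-filter⁺; ∈-cartesianProduct⁺; ∈-++⁺ˡ; ∈-++⁺ʳ; ∈-lookup)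
open import Data.List.Membership.Setoid.Properties using (index-injective)
open import Data.List.Properties using (filter-++; length-++; length-map)
open import Data.List.Relation.Unary.All using (All; []; _∷_)
import Data.List.Relation.Unary.All as All
import Data.List.Relation.Unary.All.Properties as AllP
open import Data.List.Relation.Unary.AllPairs using (AllPairs; []; _∷_; allPairs?)
import Data.List.Relation.Unary.AllPairs as AllPairs
import Data.List.Relation.Unary.AllPairs.Properties as AllPairsP
open import Data.List.Relation.Unary.Any using (here; there)
import Data.List.Relation.Unary.Any as Any
open import Data.Nat using (ℕ; zero; suc; pred; _≤_; _<_; _+_; _*_; _%_; _≤ᵇ_; z≤n; s≤s; z<s; s<s)
open import Data.Nat.DivMod using (_mod_; _/_; m<n⇒m%n≡m; m≡m%n+[m/n]*n)
open import Data.Nat.Properties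
  using (suc-injective; 1+n≢n; 0≢1+n; <⇒≢; ≤ᵇ⇒≤; m≤m+n; n≤0⇒n≡0; +-cancelˡ-≤; +-identityʳ)
import Data.Nat.Properties as ℕ
open import Data.Nat.Solver using (module +-*-Solver)
open +-*-Solver using (solve; _:+_; _:*_; _:=_; con)
open import Data.Product using (Σ; _×_; _,_; proj₁; proj₂; ∃-syntax)
open import Data.Product.Properties using (≡-dec)
open import Data.Sum using (_⊎_; inj₁; inj₂)
import Data.Sum as Sum
open import Function using (_∘_)
open import Relation.Binary.Definitions using (DecidableEquality)
open import Relation.Binary.PropositionalEquality
  using (_≡_; _≢_; refl; sym; trans; cong; cong₂; subst; subst₂; ≢-sym; setoid; module ≡-Reasoning)
open import Relation.Nullary using (¬_; Dec; yes; no; does)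
open import Relation.Nullary.Decidable
  using (T?; map′; dec-true; dec-false; _⊎-dec_; _×-dec_; ¬?; from-yes)

T-∧-intro : ∀ {a b} → T a → T b → T (a ∧ b)
T-∧-intro {true} _ tb = tb

T-not : ∀ {a} → a ≡ false → T (not a)
T-not refl = _

length-filterᵇ-map : ∀ {A B : Set} (p : B → Bool) (f : A → B) xs →
                     length (filterᵇ (p ∘ f) xs) ≡ length (filterᵇ p (map f xs))
length-filterᵇ-map p f []       = refl
length-filterᵇ-map p f (x ∷ xs) with p (f x)
... | true  = cong suc (length-filterᵇ-map p f xs)
... | false = length-filterᵇ-map p f xs

length-filterᵇ-++ : ∀ {A : Set} (p : A → Bool) xs ys →
                    length (filterᵇ p (xs ++ ys)) ≡ length (filterᵇ p xs) + length (filterᵇ p ys)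
length-filterᵇ-++ p xs ys = trans (cong length (filter-++ (T? ∘ p) xs ys)) (length-++ (filterᵇ p xs))

all-sound : ∀ {A : Set} (f : A → Bool) {xs} → T (all f xs) → ∀ {x} → x ∈ xs → T (f x)
all-sound f {xs} h = All.lookup (AllP.all⁺ f xs h)

infixr 3 _⇒ᵇ_
_⇒ᵇ_ : Bool → Bool → Bool
true  ⇒ᵇ b = b
false ⇒ᵇ _ = true

⇒ᵇ-elim : ∀ {a b} → T (a ⇒ᵇ b) → T a → T b
⇒ᵇ-elim {true} h _ = h

sumBelow : ℕ → (ℕ → ℕ) → ℕ
sumBelow zero    f = 0
sumBelow (suc t) f = sumBelow t f + f t

potential-telescope : ∀ (k d A : ℕ) (w ψ : ℕ → ℕ) t →
  k * w 0 + ψ 0 ≤ A →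
  (∀ j → j < t → k * w (suc j) + ψ (suc j) ≤ ψ j + d) →
  k * sumBelow (suc t) w + ψ t ≤ A + d * t
potential-telescope k d A w ψ zero init _ rewrite ℕ.*-zeroʳ d | +-identityʳ A = init
potential-telescope k d A w ψ (suc t) init step = begin
  k * (S + w (suc t)) + ψ (suc t)    ≡⟨ cong (_+ ψ (suc t)) (ℕ.*-distribˡ-+ k S (w (suc t))) ⟩
  k * S + k * w (suc t) + ψ (suc t)  ≡⟨ ℕ.+-assoc (k * S) _ _ ⟩
  k * S + (k * w (suc t) + ψ (suc t)) ≤⟨ ℕ.+-monoʳ-≤ (k * S) (step t ℕ.≤-refl) ⟩
  k * S + (ψ t + d)                  ≡⟨ ℕ.+-assoc (k * S) (ψ t) d ⟨
  k * S + ψ t + d                    ≤⟨ ℕ.+-monoˡ-≤ d induction-hypothesis ⟩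
  A + d * t + d                      ≡⟨ ℕ.+-assoc A (d * t) d ⟩
  A + (d * t + d)                    ≡⟨ cong (A +_) (trans (ℕ.+-comm (d * t) d) (sym (ℕ.*-suc d t))) ⟩
  A + d * suc t                      ∎
  where
  open ℕ.≤-Reasoning
  S = sumBelow (suc t) w
  induction-hypothesis : k * S + ψ t ≤ A + d * t
  induction-hypothesis = potential-telescope k d A w ψ t init λ j j<t → step j (ℕ.m<n⇒m<1+n j<t)

-- The label of a vertex: N if it is unmatched, otherwise the direction of its partner,
-- where D points to the next row and R to the next column.
data Label : Set where
  N U D L R : Label

labelCode : Label → ℕ
labelCode N = 0
labelCode U = 1
labelCode D = 2
labelCode L = 3
labelCode R = 4

labelDecode : ℕ → Label
labelDecode 0 = N
labelDecode 1 = U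
labelDecode 2 = D
labelDecode 3 = L
labelDecode _ = R

labelDecode-code : ∀ x → labelDecode (labelCode x) ≡ x
labelDecode-code N = refl
labelDecode-code U = refl
labelDecode-code D = refl
labelDecode-code L = refl
labelDecode-code R = refl

_≟_ : DecidableEquality Label
x ≟ y = map′ code-injective (cong labelCode) (labelCode x ℕ.≟ labelCode y)
  where
  code-injective : labelCode x ≡ labelCode y → x ≡ y
  code-injective eq = trans (sym (labelDecode-code x))
                            (trans (cong labelDecode eq) (labelDecode-code y))

_==_ : Label → Label → Bool
x == y = does (x ≟ y)

opposite : Label → Label
opposite N = N
opposite U = D
opposite D = U
opposite L = R
opposite R = L

-- Every edge is counted at its upper or left endpoint.
isHead : Label → Bool
isHead D = true
isHead R = true
isHead _ = false

opposite≢N : ∀ {d} → d ≢ N → opposite d ≢ N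
opposite≢N {N} d≢N = d≢N
opposite≢N {U} _ ()
opposite≢N {D} _ ()
opposite≢N {L} _ ()
opposite≢N {R} _ ()

==-refl : ∀ x → (x == x) ≡ true
==-refl x = dec-true (x ≟ x) refl

==-≢ : ∀ {x y} → x ≢ y → (x == y) ≡ false
==-≢ {x} {y} = dec-false (x ≟ y)

isHead-opposite : ∀ {d} → d ≢ N → isHead d ≡ false → isHead (opposite d) ≡ true
isHead-opposite {N} d≢N _ = ⊥-elim (d≢N refl)
isHead-opposite {U} _ _ = refl
isHead-opposite {L} _ _ = refl

-- For neighbours x, y with y in direction d from x: x points to y iff y points back to x,
-- and x and y are not both matched unless to each other.
consistentᵇ : Label → Label → Label → Bool
consistentᵇ d x y = not ((x == d) xor (y == opposite d)) ∧ (x == d ∨ x == N ∨ y == N)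

consistent-NN : ∀ {d} → d ≢ N → T (consistentᵇ d N N)
consistent-NN {d} d≢N
  rewrite ==-≢ (≢-sym d≢N) | ==-≢ (≢-sym (opposite≢N d≢N)) = _

consistent-xN : ∀ {d x} → d ≢ N → x ≢ d → T (consistentᵇ d x N)
consistent-xN {d} {x} d≢N x≢d
  rewrite ==-≢ x≢d | ==-≢ (≢-sym (opposite≢N d≢N)) | ∨-zeroʳ (x == N) = _

consistent-Ny : ∀ {d y} → d ≢ N → y ≢ opposite d → T (consistentᵇ d N y)
consistent-Ny {d} d≢N y≢d'
  rewrite ==-≢ (≢-sym d≢N) | ==-≢ y≢d' = _

consistent-partners : ∀ d → T (consistentᵇ d d (opposite d))
consistent-partners d rewrite ==-refl d | ==-refl (opposite d) = _

Adj1-irrefl : ∀ {a : ℕ} → ¬ Adj1 a a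
Adj1-irrefl (inj₁ eq) = 1+n≢n eq
Adj1-irrefl (inj₂ eq) = 1+n≢n eq

Adj1-exclusive : ∀ {a b : ℕ} → suc a ≡ b → suc b ≡ a → ⊥
Adj1-exclusive {zero}  refl ()
Adj1-exclusive {suc a} refl eq = Adj1-exclusive {a} refl (suc-injective eq)

Adj1? : ∀ a b → Dec (Adj1 a b)
Adj1? a b = (suc a ℕ.≟ b) ⊎-dec (suc b ℕ.≟ a)

coordinates : ∀ {n m} → Vertex n m → ℕ × ℕ
coordinates (i , j) = toℕ i , toℕ j

coordinates-injective : ∀ {n m} {x y : Vertex n m} → coordinates x ≡ coordinates y → x ≡ y
coordinates-injective {x = i , j} {k , l} eq
  with refl ← toℕ-injective {i = i} {k} (cong proj₁ eq)
     | refl ← toℕ-injective {i = j} {l} (cong proj₂ eq) = refl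

neighbour : Label → ℕ × ℕ → ℕ × ℕ
neighbour N (a , b) = a , b
neighbour U (a , b) = pred a , b
neighbour D (a , b) = suc a , b
neighbour L (a , b) = a , pred b
neighbour R (a , b) = a , suc b

module _ {n m : ℕ} where

  GridAdj-sym : {x y : Vertex n m} → GridAdj n m x y → GridAdj n m y x
  GridAdj-sym (inj₁ (i≡k , a)) = inj₁ (sym i≡k , Sum.swap a)
  GridAdj-sym (inj₂ (j≡l , a)) = inj₂ (sym j≡l , Sum.swap a)

  GridAdj-irrefl : {x : Vertex n m} → ¬ GridAdj n m x x
  GridAdj-irrefl (inj₁ (_ , a)) = Adj1-irrefl a
  GridAdj-irrefl (inj₂ (_ , a)) = Adj1-irrefl a

  direction : {x y : Vertex n m} → GridAdj n m x y → Label
  direction (inj₁ (_ , inj₁ _)) = R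
  direction (inj₁ (_ , inj₂ _)) = L
  direction (inj₂ (_ , inj₁ _)) = D
  direction (inj₂ (_ , inj₂ _)) = U

  direction≢N : {x y : Vertex n m} (g : GridAdj n m x y) → direction g ≢ N
  direction≢N (inj₁ (_ , inj₁ _)) ()
  direction≢N (inj₁ (_ , inj₂ _)) ()
  direction≢N (inj₂ (_ , inj₁ _)) ()
  direction≢N (inj₂ (_ , inj₂ _)) ()

  direction-sym : {x y : Vertex n m} (g : GridAdj n m x y) →
                  direction (GridAdj-sym g) ≡ opposite (direction g)
  direction-sym (inj₁ (_ , inj₁ _)) = refl
  direction-sym (inj₁ (_ , inj₂ _)) = refl
  direction-sym (inj₂ (_ , inj₁ _)) = refl
  direction-sym (inj₂ (_ , inj₂ _)) = refl

  direction-irrelevant : {x y : Vertex n m} (g h : GridAdj n m x y) → direction g ≡ direction h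
  direction-irrelevant (inj₁ (_ , inj₁ _)) (inj₁ (_ , inj₁ _)) = refl
  direction-irrelevant (inj₁ (_ , inj₂ _)) (inj₁ (_ , inj₂ _)) = refl
  direction-irrelevant (inj₂ (_ , inj₁ _)) (inj₂ (_ , inj₁ _)) = refl
  direction-irrelevant (inj₂ (_ , inj₂ _)) (inj₂ (_ , inj₂ _)) = refl
  direction-irrelevant (inj₁ (_ , inj₁ p)) (inj₁ (_ , inj₂ q)) = ⊥-elim (Adj1-exclusive p q)
  direction-irrelevant (inj₁ (_ , inj₂ p)) (inj₁ (_ , inj₁ q)) = ⊥-elim (Adj1-exclusive q p)
  direction-irrelevant (inj₂ (_ , inj₁ p)) (inj₂ (_ , inj₂ q)) = ⊥-elim (Adj1-exclusive p q)
  direction-irrelevant (inj₂ (_ , inj₂ p)) (inj₂ (_ , inj₁ q)) = ⊥-elim (Adj1-exclusive q p)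
  direction-irrelevant (inj₁ (refl , _)) (inj₂ (_ , a)) = ⊥-elim (Adj1-irrefl a)
  direction-irrelevant (inj₂ (_ , a)) (inj₁ (refl , _)) = ⊥-elim (Adj1-irrefl a)

  neighbour-direction : {x y : Vertex n m} (g : GridAdj n m x y) →
                        neighbour (direction g) (coordinates x) ≡ coordinates y
  neighbour-direction (inj₁ (refl , inj₁ eq)) = cong (_ ,_) eq
  neighbour-direction (inj₁ (refl , inj₂ eq)) = cong (_ ,_) (cong pred (sym eq))
  neighbour-direction (inj₂ (refl , inj₁ eq)) = cong (_, _) eq
  neighbour-direction (inj₂ (refl , inj₂ eq)) = cong (_, _) (cong pred (sym eq))

  direction-injective : {x y z : Vertex n m} (g : GridAdj n m x y) (h : GridAdj n m x z) →
                        direction g ≡ direction h → y ≡ z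
  direction-injective {x} g h eq = coordinates-injective (begin
    coordinates _                          ≡⟨ neighbour-direction g ⟨
    neighbour (direction g) (coordinates x) ≡⟨ cong (λ d → neighbour d (coordinates x)) eq ⟩
    neighbour (direction h) (coordinates x) ≡⟨ neighbour-direction h ⟩
    coordinates _                          ∎)
    where open ≡-Reasoning

  ¬U-from-top : {x y : Vertex n m} (g : GridAdj n m x y) → toℕ (proj₁ x) ≡ 0 → direction g ≢ U
  ¬U-from-top (inj₂ (_ , inj₂ eq)) top _ = 0≢1+n (trans (sym top) (sym eq))
  ¬U-from-top (inj₂ (_ , inj₁ _)) _ ()
  ¬U-from-top (inj₁ (_ , inj₁ _)) _ ()
  ¬U-from-top (inj₁ (_ , inj₂ _)) _ ()

  ¬D-from-bottom : {x y : Vertex n m} (g : GridAdj n m x y) → suc (toℕ (proj₁ x)) ≡ n → direction g ≢ D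
  ¬D-from-bottom {y = k , _} (inj₂ (_ , inj₁ eq)) bottom _ = <⇒≢ (subst (_< n) (sym eq) (toℕ<n k)) bottom
  ¬D-from-bottom (inj₂ (_ , inj₂ _)) _ ()
  ¬D-from-bottom (inj₁ (_ , inj₁ _)) _ ()
  ¬D-from-bottom (inj₁ (_ , inj₂ _)) _ ()

  ¬L-from-left : {x y : Vertex n m} (g : GridAdj n m x y) → toℕ (proj₂ x) ≡ 0 → direction g ≢ L
  ¬L-from-left (inj₁ (_ , inj₂ eq)) left _ = 0≢1+n (trans (sym left) (sym eq))
  ¬L-from-left (inj₁ (_ , inj₁ _)) _ ()
  ¬L-from-left (inj₂ (_ , inj₁ _)) _ ()
  ¬L-from-left (inj₂ (_ , inj₂ _)) _ ()

  ¬R-from-right : {x y : Vertex n m} (g : GridAdj n m x y) → suc (toℕ (proj₂ x)) ≡ m → direction g ≢ R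
  ¬R-from-right {y = _ , l} (inj₁ (_ , inj₁ eq)) right _ = <⇒≢ (subst (_< m) (sym eq) (toℕ<n l)) right
  ¬R-from-right (inj₁ (_ , inj₂ _)) _ ()
  ¬R-from-right (inj₂ (_ , inj₁ _)) _ ()
  ¬R-from-right (inj₂ (_ , inj₂ _)) _ ()

module _ {n m : ℕ} where

  Apart : Vertex n m → Vertex n m → Set
  Apart x y = x ≢ y × ¬ GridAdj n m x y

  Separated : Edge n m → Edge n m → Set
  Separated (a , b) (c , d) = Apart a c × Apart a d × Apart b c × Apart b d

  IsGridEdge : Edge n m → Set
  IsGridEdge (a , b) = GridAdj n m a b

  Apart-sym : ∀ {x y} → Apart x y → Apart y x
  Apart-sym (x≢y , ¬adj) = ≢-sym x≢y , ¬adj ∘ GridAdj-sym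

  Separated-sym : ∀ {e f} → Separated e f → Separated f e
  Separated-sym (ac , ad , bc , bd) = Apart-sym ac , Apart-sym bc , Apart-sym ad , Apart-sym bd

  Separated-ends : ∀ {e f x y} → Separated e f → Ends e x → Ends f y → Apart x y
  Separated-ends (ac , _  , _  , _ ) (inj₁ refl) (inj₁ refl) = ac
  Separated-ends (_  , ad , _  , _ ) (inj₁ refl) (inj₂ refl) = ad
  Separated-ends (_  , _  , bc , _ ) (inj₂ refl) (inj₁ refl) = bc
  Separated-ends (_  , _  , _  , bd) (inj₂ refl) (inj₂ refl) = bd

  adjacent? : ∀ x y → Dec (GridAdj n m x y)
  adjacent? (i , j) (k , l) = ((i Fin.≟ k) ×-dec Adj1? (toℕ j) (toℕ l))
                        ⊎-dec ((j Fin.≟ l) ×-dec Adj1? (toℕ i) (toℕ k))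

  apart? : ∀ x y → Dec (Apart x y)
  apart? x y = ¬? (≡-dec Fin._≟_ Fin._≟_ x y) ×-dec ¬? (adjacent? x y)

  separated? : ∀ e f → Dec (Separated e f)
  separated? (a , b) (c , d) = apart? a c ×-dec apart? a d ×-dec apart? b c ×-dec apart? b d

  isGridEdge? : ∀ e → Dec (IsGridEdge e)
  isGridEdge? (a , b) = adjacent? a b

  AllPairs-lookup : ∀ {M : List (Edge n m)} → AllPairs Separated M →
                    ∀ p q → p ≢ q → Separated (lookup M p) (lookup M q)
  AllPairs-lookup (_  ∷ _) zero zero p≢q = ⊥-elim (p≢q refl)
  AllPairs-lookup (es ∷ _) zero (suc q) _ = All.lookup es (∈-lookup q)
  AllPairs-lookup (es ∷ _) (suc p) zero _ = Separated-sym (All.lookup es (∈-lookup p))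
  AllPairs-lookup (_ ∷ ss) (suc p) (suc q) p≢q = AllPairs-lookup ss p q (p≢q ∘ cong suc)

  separated⇒inducedMatching : ∀ {M : List (Edge n m)} → All IsGridEdge M → AllPairs Separated M →
                              IsInducedMatching n m M
  separated⇒inducedMatching {M} edges separated = record
    { isEdge   = λ p → All.lookup edges (∈-lookup p)
    ; disjoint = λ p q p≢q x ex ey → proj₁ (apart p q p≢q ex ey) refl
    ; induced  = λ p q p≢q x y ex ey → proj₂ (apart p q p≢q ex ey)
    }
    where
    apart : ∀ p q → p ≢ q → ∀ {x y} → Ends (lookup M p) x → Ends (lookup M q) y → Apart x y
    apart p q p≢q = Separated-ends (AllPairs-lookup separated p q p≢q)

Adj1-+⁺ : ∀ k {a b} → Adj1 a b → Adj1 (k + a) (k + b)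
Adj1-+⁺ zero    adj = adj
Adj1-+⁺ (suc k) adj = Sum.map (cong suc) (cong suc) (Adj1-+⁺ k adj)

Adj1-+⁻ : ∀ k {a b} → Adj1 (k + a) (k + b) → Adj1 a b
Adj1-+⁻ zero    adj = adj
Adj1-+⁻ (suc k) adj = Adj1-+⁻ k (Sum.map suc-injective suc-injective adj)

module _ {n m : ℕ} (k : ℕ) where

  shiftVertex : Vertex n m → Vertex n (k + m)
  shiftVertex (i , j) = i , k ↑ʳ j

  shiftEdge : Edge n m → Edge n (k + m)
  shiftEdge (a , b) = shiftVertex a , shiftVertex b

  shift-adjacent⁺ : ∀ {x y} → GridAdj n m x y → GridAdj n (k + m) (shiftVertex x) (shiftVertex y)
  shift-adjacent⁺ {_ , j} {_ , l} (inj₁ (i≡i′ , adj)) =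
    inj₁ (i≡i′ , subst₂ Adj1 (sym (toℕ-↑ʳ k j)) (sym (toℕ-↑ʳ k l)) (Adj1-+⁺ k adj))
  shift-adjacent⁺ (inj₂ (j≡l , adj)) = inj₂ (cong (k ↑ʳ_) j≡l , adj)

  shift-adjacent⁻ : ∀ {x y} → GridAdj n (k + m) (shiftVertex x) (shiftVertex y) → GridAdj n m x y
  shift-adjacent⁻ {_ , j} {_ , l} (inj₁ (i≡i′ , adj)) =
    inj₁ (i≡i′ , Adj1-+⁻ k (subst₂ Adj1 (toℕ-↑ʳ k j) (toℕ-↑ʳ k l) adj))
  shift-adjacent⁻ {_ , j} {_ , l} (inj₂ (j≡l , adj)) = inj₂ (↑ʳ-injective k j l j≡l , adj)

  shift-apart : ∀ {x y} → Apart x y → Apart (shiftVertex x) (shiftVertex y)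
  shift-apart {_ , j} {_ , l} (x≢y , ¬adj) =
    (λ eq → x≢y (cong₂ _,_ (cong proj₁ eq) (↑ʳ-injective k j l (cong proj₂ eq)))) ,
    ¬adj ∘ shift-adjacent⁻

  shift-separated : ∀ {e f} → Separated e f → Separated (shiftEdge e) (shiftEdge f)
  shift-separated (ac , ad , bc , bd) = shift-apart ac , shift-apart ad , shift-apart bc , shift-apart bd

  apart-across : ∀ (x : Vertex n (k + m)) (y : Vertex n m) → toℕ (proj₂ x) < k →
                 (suc (toℕ (proj₂ x)) ≡ k → toℕ (proj₂ y) ≡ 0 → proj₁ x ≢ proj₁ y) →
                 Apart x (shiftVertex y)
  apart-across (i , j) (i′ , j′) j<k seam = distinct , nonadjacent
    where
    k≤shifted : k ≤ toℕ (k ↑ʳ j′)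
    k≤shifted = subst (k ≤_) (sym (toℕ-↑ʳ k j′)) (m≤m+n k (toℕ j′))

    distinct : (i , j) ≢ (i′ , k ↑ʳ j′)
    distinct eq = ℕ.<⇒≱ j<k (subst (λ c → k ≤ toℕ c) (sym (cong proj₂ eq)) k≤shifted)

    nonadjacent : ¬ GridAdj n (k + m) (i , j) (i′ , k ↑ʳ j′)
    nonadjacent (inj₂ (j≡ , _)) = ℕ.<⇒≱ j<k (subst (λ c → k ≤ toℕ c) (sym j≡) k≤shifted)
    nonadjacent (inj₁ (_ , inj₂ e)) =
      ℕ.<⇒≱ j<k (ℕ.≤-trans k≤shifted (subst (toℕ (k ↑ʳ j′) ≤_) e (ℕ.n≤1+n _)))
    nonadjacent (inj₁ (i≡i′ , inj₁ e)) = seam j-last j′-first i≡i′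
      where
      e′ : suc (toℕ j) ≡ k + toℕ j′
      e′ = trans e (toℕ-↑ʳ k j′)
      j′-first : toℕ j′ ≡ 0
      j′-first = n≤0⇒n≡0 (+-cancelˡ-≤ k (toℕ j′) 0 (subst₂ _≤_ e′ (sym (+-identityʳ k)) j<k))
      j-last : suc (toℕ j) ≡ k
      j-last = trans e′ (trans (cong (k +_) j′-first) (+-identityʳ k))

-- The labelling induced by an induced matching

module Labelling {n m : ℕ} (M : List (Edge n m)) (isIM : IsInducedMatching n m M) where
  open IsInducedMatching isIM

  ContainsEdge-sym : ∀ {x y} → ContainsEdge M x y → ContainsEdge M y x
  ContainsEdge-sym (p , e) = p , Sum.swap e

  ContainsEdge-ends : ∀ {x y} (c : ContainsEdge M x y) → Ends (lookup M (proj₁ c)) x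
  ContainsEdge-ends (_ , inj₁ e) = inj₁ (cong proj₁ (sym e))
  ContainsEdge-ends (_ , inj₂ e) = inj₂ (cong proj₂ (sym e))

  Matched : Vertex n m → Set
  Matched x = ∃[ p ] Ends (lookup M p) x

  matched? : ∀ x → Dec (Matched x)
  matched? x = Fin.any? λ p → (x ≟V proj₁ (lookup M p)) ⊎-dec (x ≟V proj₂ (lookup M p))
    where _≟V_ = ≡-dec Fin._≟_ Fin._≟_

  matched : ∀ {x y} → ContainsEdge M x y → Matched x
  matched c = proj₁ c , ContainsEdge-ends c

  endpoint-unique : ∀ {p q x} → Ends (lookup M p) x → Ends (lookup M q) x → p ≡ q
  endpoint-unique {p} {q} ex eq with p Fin.≟ q
  ... | yes p≡q = p≡q
  ... | no p≢q = ⊥-elim (disjoint p q p≢q _ ex eq)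

  partner-unique : ∀ {x y z} → ContainsEdge M x y → ContainsEdge M x z → y ≡ z
  partner-unique c₁@(p , e₁) c₂@(q , e₂)
    with refl ← endpoint-unique {p} {q} (ContainsEdge-ends c₁) (ContainsEdge-ends c₂) = same-edge e₁ e₂
    where
    same-edge : ∀ {e x y z} → (e ≡ (x , y)) ⊎ (e ≡ (y , x)) → (e ≡ (x , z)) ⊎ (e ≡ (z , x)) → y ≡ z
    same-edge (inj₁ refl) (inj₁ refl) = refl
    same-edge (inj₁ refl) (inj₂ refl) = refl
    same-edge (inj₂ refl) (inj₁ refl) = refl
    same-edge (inj₂ refl) (inj₂ refl) = refl

  adjacent-matched : ∀ {x y} → GridAdj n m x y → Matched x → Matched y → ContainsEdge M x y
  adjacent-matched {x} {y} g (p , ex) (q , ey) with p Fin.≟ q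
  ... | no p≢q = ⊥-elim (induced p q p≢q x y ex ey g)
  ... | yes refl = p , orient ex ey
    where
    orient : ∀ {e} → Ends e x → Ends e y → (e ≡ (x , y)) ⊎ (e ≡ (y , x))
    orient (inj₁ refl) (inj₂ refl) = inj₁ refl
    orient (inj₂ refl) (inj₁ refl) = inj₂ refl
    orient (inj₁ refl) (inj₁ refl) = ⊥-elim (GridAdj-irrefl g)
    orient (inj₂ refl) (inj₂ refl) = ⊥-elim (GridAdj-irrefl g)

  towardsPartner : ∀ {x} (e : Edge n m) → GridAdj n m (proj₁ e) (proj₂ e) → Ends e x → Label
  towardsPartner _ g (inj₁ refl) = direction g
  towardsPartner _ g (inj₂ refl) = direction (GridAdj-sym g)

  labelFrom : ∀ x → Dec (Matched x) → Label
  labelFrom x (yes (p , ex)) = towardsPartner (lookup M p) (isEdge p) ex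
  labelFrom x (no _) = N

  label : Vertex n m → Label
  label x = labelFrom x (matched? x)

  label-cases : ∀ x → (¬ Matched x × label x ≡ N) ⊎
                      (∃[ y ] Σ (GridAdj n m x y) λ g → ContainsEdge M x y × label x ≡ direction g)
  label-cases x with matched? x
  ... | no ¬matched = inj₁ (¬matched , refl)
  ... | yes (p , inj₁ refl) = inj₂ (proj₂ (lookup M p) , isEdge p , (p , inj₁ refl) , refl)
  ... | yes (p , inj₂ refl) = inj₂ (proj₁ (lookup M p) , GridAdj-sym (isEdge p) , (p , inj₂ refl) , refl)

  label-partner : ∀ {x y} → ContainsEdge M x y → (g : GridAdj n m x y) → label x ≡ direction g
  label-partner {x} c g with label-cases x
  ... | inj₁ (¬matched , _) = ⊥-elim (¬matched (matched c))
  ... | inj₂ (_ , h , c′ , lx) with refl ← partner-unique c′ c = trans lx (direction-irrelevant h g)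

  label-partner-opposite : ∀ {x y} → ContainsEdge M x y → (g : GridAdj n m x y) →
                           label y ≡ opposite (direction g)
  label-partner-opposite c g = trans (label-partner (ContainsEdge-sym c) (GridAdj-sym g)) (direction-sym g)

  label-consistent : ∀ {x y} (g : GridAdj n m x y) → T (consistentᵇ (direction g) (label x) (label y))
  label-consistent {x} {y} g with label-cases x | label-cases y
  ... | inj₁ (_ , lx) | inj₁ (_ , ly) rewrite lx | ly = consistent-NN (direction≢N g)
  ... | inj₂ (z , h , c , lx) | inj₁ (¬my , ly) rewrite lx | ly =
    consistent-xN (direction≢N g) λ eq →
      ¬my (matched (ContainsEdge-sym (subst (ContainsEdge M x) (direction-injective h g eq) c)))
  ... | inj₁ (¬mx , lx) | inj₂ (z , h , c , ly) rewrite lx | ly =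
    consistent-Ny (direction≢N g) λ eq →
      ¬mx (matched (ContainsEdge-sym (subst (ContainsEdge M y) (direction-injective h (GridAdj-sym g)
        (trans eq (sym (direction-sym g)))) c)))
  ... | inj₂ (_ , _ , cx , _) | inj₂ (_ , _ , cy , _)
    rewrite label-partner (adjacent-matched g (matched cx) (matched cy)) g
          | label-partner-opposite (adjacent-matched g (matched cx) (matched cy)) g =
    consistent-partners (direction g)

  label-avoids : ∀ {x d} → d ≢ N → (∀ {y} (g : GridAdj n m x y) → direction g ≢ d) → label x ≢ d
  label-avoids {x} d≢N avoid eq with label-cases x
  ... | inj₁ (_ , lx) = d≢N (trans (sym eq) lx)
  ... | inj₂ (_ , g , _ , lx) = avoid g (trans (sym lx) eq)

  head : Fin (length M) → Vertex n m
  head p = if isHead (direction (isEdge p)) then proj₁ (lookup M p) else proj₂ (lookup M p)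

  head-ends : ∀ p → Ends (lookup M p) (head p)
  head-ends p with isHead (direction (isEdge p))
  ... | true = inj₁ refl
  ... | false = inj₂ refl

  head-isHead : ∀ p → T (isHead (label (head p)))
  head-isHead p with isHead (direction (isEdge p)) in eq
  ... | true rewrite label-partner (p , inj₁ refl) (isEdge p) | eq = _
  ... | false rewrite label-partner-opposite (p , inj₁ refl) (isEdge p)
                    | isHead-opposite (direction≢N (isEdge p)) eq = _

  length≤heads : (vs : List (Vertex n m)) → (∀ x → x ∈ vs) →
                 length M ≤ length (filterᵇ (isHead ∘ label) vs)
  length≤heads vs complete = Fin.injective⇒≤ position-injective
    where
    head∈ : ∀ p → head p ∈ filterᵇ (isHead ∘ label) vs
    head∈ p = ∈-filter⁺ (T? ∘ isHead ∘ label) (complete (head p)) (head-isHead p)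

    position : Fin (length M) → Fin (length (filterᵇ (isHead ∘ label) vs))
    position p = Any.index (head∈ p)

    position-injective : ∀ {p q} → position p ≡ position q → p ≡ q
    position-injective {p} {q} eq = endpoint-unique (head-ends p)
      (subst (Ends (lookup M q)) (sym (index-injective (setoid _) (head∈ p) (head∈ q) eq)) (head-ends q))

-- Column states and the potential

State : Set
State = Label × Label × Label

validᵇ : State → Bool
validᵇ (a , b , c) = consistentᵇ D a b ∧ consistentᵇ D b c ∧ not (a == U) ∧ not (c == D)

stepᵇ : State → State → Bool
stepᵇ (a , b , c) (a′ , b′ , c′) = consistentᵇ R a a′ ∧ consistentᵇ R b b′ ∧ consistentᵇ R c c′

initialᵇ : State → Bool
initialᵇ (a , b , c) = not (a == L) ∧ not (b == L) ∧ not (c == L)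

finalᵇ : State → Bool
finalᵇ (a , b , c) = not (a == R) ∧ not (b == R) ∧ not (c == R)

weight : State → ℕ
weight (a , b , c) = length (filterᵇ isHead (a ∷ b ∷ c ∷ []))

data Phase : Set where
  before first gap₁ gap₂ second after : Phase

nextᵇ : Phase → Phase → Bool
nextᵇ before before = true
nextᵇ before first  = true
nextᵇ first  gap₁   = true
nextᵇ gap₁   gap₂   = true
nextᵇ gap₂   second = true
nextᵇ second after  = true
nextᵇ after  after  = true
nextᵇ _      _      = false

initialPhaseᵇ : Phase → Bool
initialPhaseᵇ before = true
initialPhaseᵇ first  = true
initialPhaseᵇ _      = false

finalPhaseᵇ : Phase → Bool
finalPhaseᵇ second = true
finalPhaseᵇ after  = true
finalPhaseᵇ _      = false

forcedᵇ : Phase → State → Bool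
forcedᵇ first  (a , b , _) = (a == D) ∧ (b == U)
forcedᵇ second (a , b , _) = (a == D) ∧ (b == U)
forcedᵇ _      _           = true

byPhase : ℕ → ℕ → ℕ → ℕ → ℕ → ℕ → Phase → ℕ
byPhase v _ _ _ _ _ before = v
byPhase _ v _ _ _ _ first  = v
byPhase _ _ v _ _ _ gap₁   = v
byPhase _ _ _ v _ _ gap₂   = v
byPhase _ _ _ _ v _ second = v
byPhase _ _ _ _ _ v after  = v

-- The least solution of the three inequalities below, found by a longest-path computation
-- on the configuration graph; each inequality is then checked by evaluating it on all valid
-- configurations.
potential : State → Phase → ℕ
potential (N , N , N) = byPhase 5 0 5 6 0 7
potential (N , N , L) = byPhase 5 0 3 6 0 6
potential (N , N , R) = byPhase 3 0 3 0 0 4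
potential (N , D , U) = byPhase 4 0 3 0 0 5
potential (N , L , N) = byPhase 5 0 5 0 0 7
potential (N , R , N) = byPhase 2 0 0 0 0 4
potential (D , U , N) = byPhase 4 4 3 0 5 5
potential (L , N , N) = byPhase 5 0 3 0 0 6
potential (L , N , L) = byPhase 3 0 3 0 0 5
potential (L , N , R) = byPhase 2 0 3 0 0 3
potential (R , N , N) = byPhase 3 0 1 0 0 4
potential (R , N , L) = byPhase 2 0 0 0 0 3
potential (R , N , R) = byPhase 0 0 0 0 0 2
potential _           = λ _ → 0

labels : List Label
labels = N ∷ U ∷ D ∷ L ∷ R ∷ []

∈-labels : ∀ x → x ∈ labels
∈-labels N = here refl
∈-labels U = there (here refl)
∈-labels D = there (there (here refl))
∈-labels L = there (there (there (here refl)))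
∈-labels R = there (there (there (there (here refl))))

phases : List Phase
phases = before ∷ first ∷ gap₁ ∷ gap₂ ∷ second ∷ after ∷ []

∈-phases : ∀ p → p ∈ phases
∈-phases before = here refl
∈-phases first  = there (here refl)
∈-phases gap₁   = there (there (here refl))
∈-phases gap₂   = there (there (there (here refl)))
∈-phases second = there (there (there (there (here refl))))
∈-phases after  = there (there (there (there (there (here refl)))))

configurations : List (State × Phase)
configurations = cartesianProduct (filterᵇ validᵇ (cartesianProduct labels (cartesianProduct labels labels))) phases

∈-configurations : ∀ {x} p → T (validᵇ x) → (x , p) ∈ configurations
∈-configurations {a , b , c} p v = ∈-cartesianProduct⁺
  (∈-filter⁺ (T? ∘ validᵇ) (∈-cartesianProduct⁺ (∈-labels a) (∈-cartesianProduct⁺ (∈-labels b) (∈-labels c))) v)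
  (∈-phases p)

potential-step : ∀ {x y p q} → T (validᵇ x) → T (validᵇ y) → T (stepᵇ x y) → T (nextᵇ p q) →
                 T (forcedᵇ p x) → T (forcedᵇ q y) → 4 * weight y + potential y q ≤ potential x p + 3
potential-step {x} {y} {p} {q} vx vy sxy npq fx fy = ≤ᵇ⇒≤ _ _
  (⇒ᵇ-elim (⇒ᵇ-elim (⇒ᵇ-elim (⇒ᵇ-elim (all-sound check checked {(x , p) , (y , q)}
    (∈-cartesianProduct⁺ (∈-configurations p vx) (∈-configurations q vy))) sxy) npq) fx) fy)
  where
  check : (State × Phase) × (State × Phase) → Bool
  check ((x , p) , (y , q)) = stepᵇ x y ⇒ᵇ nextᵇ p q ⇒ᵇ forcedᵇ p x ⇒ᵇ forcedᵇ q y ⇒ᵇ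
                              4 * weight y + potential y q ≤ᵇ potential x p + 3

  checked : T (all check (cartesianProduct configurations configurations))
  checked = _

potential-initial : ∀ {x p} → T (validᵇ x) → T (initialᵇ x) → T (initialPhaseᵇ p) → T (forcedᵇ p x) →
                    4 * weight x + potential x p ≤ 8
potential-initial {x} {p} vx ix ip fx = ≤ᵇ⇒≤ _ _
  (⇒ᵇ-elim (⇒ᵇ-elim (⇒ᵇ-elim (all-sound check checked {x , p} (∈-configurations p vx)) ix) ip) fx)
  where
  check : State × Phase → Bool
  check (x , p) = initialᵇ x ⇒ᵇ initialPhaseᵇ p ⇒ᵇ forcedᵇ p x ⇒ᵇ 4 * weight x + potential x p ≤ᵇ 8

  checked : T (all check configurations)
  checked = _

potential-final : ∀ {x p} → T (validᵇ x) → T (finalᵇ x) → T (finalPhaseᵇ p) → T (forcedᵇ p x) →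
                  5 ≤ potential x p
potential-final {x} {p} vx ix ip fx = ≤ᵇ⇒≤ _ _
  (⇒ᵇ-elim (⇒ᵇ-elim (⇒ᵇ-elim (all-sound check checked {x , p} (∈-configurations p vx)) ix) ip) fx)
  where
  check : State × Phase → Bool
  check (x , p) = finalᵇ x ⇒ᵇ finalPhaseᵇ p ⇒ᵇ forcedᵇ p x ⇒ᵇ 5 ≤ᵇ potential x p

  checked : T (all check configurations)
  checked = _

-- The upper bound

phase : ℕ → ℕ → Phase
phase zero    zero                      = first
phase zero    (suc zero)                = gap₁
phase zero    (suc (suc zero))          = gap₂
phase zero    (suc (suc (suc zero)))    = second
phase zero    (suc (suc (suc (suc _)))) = after
phase (suc c) zero                      = before
phase (suc c) (suc j)                   = phase c j

phase-initial : ∀ c → T (initialPhaseᵇ (phase c 0))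
phase-initial zero    = _
phase-initial (suc c) = _

phase-next : ∀ c j → T (nextᵇ (phase c j) (phase c (suc j)))
phase-next zero    zero                      = _
phase-next zero    (suc zero)                = _
phase-next zero    (suc (suc zero))          = _
phase-next zero    (suc (suc (suc zero)))    = _
phase-next zero    (suc (suc (suc (suc _)))) = _
phase-next (suc zero)    zero                = _
phase-next (suc (suc c)) zero                = _
phase-next (suc c) (suc j)                   = phase-next c j

phase-final : ∀ c j → c + 3 ≤ j → T (finalPhaseᵇ (phase c j))
phase-final zero    (suc (suc (suc zero)))    _         = _
phase-final zero    (suc (suc (suc (suc _)))) _         = _
phase-final (suc c) (suc j)                   (s≤s c+3≤j) = phase-final c j c+3≤j
phase-final zero    (suc zero)                (s≤s ())
phase-final zero    (suc (suc zero))          (s≤s (s≤s ()))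

phase-first : ∀ c j → phase c j ≡ first → j ≡ c
phase-first zero    zero    _  = refl
phase-first (suc c) (suc j) eq = cong suc (phase-first c j eq)
phase-first zero    (suc zero)                ()
phase-first zero    (suc (suc zero))          ()
phase-first zero    (suc (suc (suc zero)))    ()
phase-first zero    (suc (suc (suc (suc _)))) ()
phase-first (suc c) zero                      ()

phase-second : ∀ c j → phase c j ≡ second → j ≡ c + 3
phase-second zero    (suc (suc (suc zero))) _  = refl
phase-second (suc c) (suc j)                eq = cong suc (phase-second c j eq)
phase-second zero    zero                      ()
phase-second zero    (suc zero)                ()
phase-second zero    (suc (suc zero))          ()
phase-second zero    (suc (suc (suc (suc _)))) ()
phase-second (suc c) zero                      ()

module Columns {m′ : ℕ} (M : List (Edge 3 (suc m′))) (isIM : IsInducedMatching 3 (suc m′) M) where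
  open Labelling M isIM

  column : ℕ → Fin (suc m′)
  column j = j mod suc m′

  toℕ-column : ∀ {j} → j < suc m′ → toℕ (column j) ≡ j
  toℕ-column {j} j<m = trans (toℕ-fromℕ< _) (m<n⇒m%n≡m j<m)

  column-fromℕ< : ∀ {j} (j<m : j < suc m′) → column j ≡ fromℕ< j<m
  column-fromℕ< j<m = toℕ-injective (trans (toℕ-column j<m) (sym (toℕ-fromℕ< j<m)))

  cell : Fin 3 → ℕ → Vertex 3 (suc m′)
  cell i j = i , column j

  columnVertices : ℕ → List (Vertex 3 (suc m′))
  columnVertices j = cell 0F j ∷ cell 1F j ∷ cell 2F j ∷ []

  columnState : ℕ → State
  columnState j = label (cell 0F j) , label (cell 1F j) , label (cell 2F j)

  columnState-valid : ∀ j → T (validᵇ (columnState j))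
  columnState-valid j =
    T-∧-intro (label-consistent {cell 0F j} (inj₂ (refl , inj₁ refl))) (
    T-∧-intro (label-consistent {cell 1F j} (inj₂ (refl , inj₁ refl))) (
    T-∧-intro (T-not (==-≢ (label-avoids (λ ()) λ g → ¬U-from-top g refl)))
              (T-not (==-≢ (label-avoids (λ ()) λ g → ¬D-from-bottom g refl)))))

  columnState-step : ∀ j → suc j < suc m′ → T (stepᵇ (columnState j) (columnState (suc j)))
  columnState-step j sj<m =
    T-∧-intro (label-consistent {cell 0F j} right) (
    T-∧-intro (label-consistent {cell 1F j} right)
              (label-consistent {cell 2F j} right))
    where
    right : ∀ {i} → GridAdj 3 (suc m′) (cell i j) (cell i (suc j))
    right = inj₁ (refl , inj₁ (trans (cong suc (toℕ-column (ℕ.<-trans (ℕ.n<1+n j) sj<m)))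
                                     (sym (toℕ-column sj<m))))

  columnState-initial : T (initialᵇ (columnState 0))
  columnState-initial = T-∧-intro (no-left 0F) (T-∧-intro (no-left 1F) (no-left 2F))
    where
    no-left : ∀ i → T (not (label (cell i 0) == L))
    no-left i = T-not (==-≢ (label-avoids (λ ()) λ g → ¬L-from-left g (toℕ-column (s≤s z≤n))))

  columnState-final : T (finalᵇ (columnState m′))
  columnState-final = T-∧-intro (no-right 0F) (T-∧-intro (no-right 1F) (no-right 2F))
    where
    no-right : ∀ i → T (not (label (cell i m′) == R))
    no-right i = T-not (==-≢ (label-avoids (λ ()) λ g → ¬R-from-right g (cong suc (toℕ-column ℕ.≤-refl))))

  columnState-vertical : ∀ {j} → ContainsEdge M (cell 0F j) (cell 1F j) →
                         T ((label (cell 0F j) == D) ∧ (label (cell 1F j) == U))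
  columnState-vertical c
    rewrite label-partner c (inj₂ (refl , inj₁ refl))
          | label-partner-opposite c (inj₂ (refl , inj₁ refl)) = _

  verticesBelow : ℕ → List (Vertex 3 (suc m′))
  verticesBelow zero    = []
  verticesBelow (suc t) = verticesBelow t ++ columnVertices t

  ∈-verticesBelow : ∀ i {j t} → j < t → cell i j ∈ verticesBelow t
  ∈-verticesBelow i {j} {suc t} j<1+t with ℕ.m<1+n⇒m<n∨m≡n j<1+t
  ... | inj₁ j<t  = ∈-++⁺ˡ (∈-verticesBelow i j<t)
  ... | inj₂ refl = ∈-++⁺ʳ (verticesBelow t) (∈-column i)
    where
    ∈-column : ∀ i → cell i j ∈ columnVertices j
    ∈-column 0F = here refl
    ∈-column 1F = there (here refl)
    ∈-column 2F = there (there (here refl))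

  heads-verticesBelow : ∀ t → length (filterᵇ (isHead ∘ label) (verticesBelow t)) ≡
                              sumBelow t (weight ∘ columnState)
  heads-verticesBelow zero    = refl
  heads-verticesBelow (suc t) =
    trans (length-filterᵇ-++ (isHead ∘ label) (verticesBelow t) (columnVertices t))
          (cong₂ _+_ (heads-verticesBelow t) (length-filterᵇ-map isHead label (columnVertices t)))

  length≤weights : length M ≤ sumBelow (suc m′) (weight ∘ columnState)
  length≤weights = subst (length M ≤_) (heads-verticesBelow (suc m′)) (length≤heads _ complete)
    where
    complete : ∀ x → x ∈ verticesBelow (suc m′)
    complete (i , j) = subst (λ j′ → (i , j′) ∈ _)
      (toℕ-injective (toℕ-column (toℕ<n j))) (∈-verticesBelow i (toℕ<n j))

vertical-pair⇒4*length≤3*m : ∀ {m′} (M : List (Edge 3 (suc m′))) → IsInducedMatching 3 (suc m′) M →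
  (c : ℕ) (c<m : c < suc m′) (c3<m : c + 3 < suc m′) →
  ContainsEdge M (zero , fromℕ< c<m) (suc zero , fromℕ< c<m) →
  ContainsEdge M (zero , fromℕ< c3<m) (suc zero , fromℕ< c3<m) →
  4 * length M ≤ 3 * suc m′
vertical-pair⇒4*length≤3*m {m′} M isIM c c<m c3<m E₁ E₂ = ℕ.+-cancelʳ-≤ 5 _ _ (begin
  4 * length M + 5               ≤⟨ ℕ.+-mono-≤ (ℕ.*-monoʳ-≤ 4 length≤weights) final ⟩
  4 * sumBelow (suc m′) w + ψ m′ ≤⟨ telescoped ⟩
  8 + 3 * m′                     ≡⟨ solve 1 (λ m → con 8 :+ con 3 :* m := con 3 :* (con 1 :+ m) :+ con 5) refl m′ ⟩
  3 * suc m′ + 5                 ∎)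
  where
  open Columns M isIM
  open ℕ.≤-Reasoning

  forced : ∀ j → T (forcedᵇ (phase c j) (columnState j))
  forced j with phase c j in eq
  ... | before = _
  ... | gap₁   = _
  ... | gap₂   = _
  ... | after  = _
  ... | first  rewrite phase-first c j eq =
    columnState-vertical {c} (subst (λ k → ContainsEdge M (0F , k) (1F , k)) (sym (column-fromℕ< c<m)) E₁)
  ... | second rewrite phase-second c j eq =
    columnState-vertical {c + 3} (subst (λ k → ContainsEdge M (0F , k) (1F , k)) (sym (column-fromℕ< c3<m)) E₂)

  w ψ : ℕ → ℕ
  w j = weight (columnState j)
  ψ j = potential (columnState j) (phase c j)

  telescoped : 4 * sumBelow (suc m′) w + ψ m′ ≤ 8 + 3 * m′
  telescoped = potential-telescope 4 3 8 w ψ m′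
    (potential-initial (columnState-valid 0) columnState-initial (phase-initial c) (forced 0))
    (λ j j<m′ → potential-step (columnState-valid j) (columnState-valid (suc j))
      (columnState-step j (s≤s j<m′)) (phase-next c j) (forced j) (forced (suc j)))

  final : 5 ≤ ψ m′
  final = potential-final (columnState-valid m′) columnState-final
    (phase-final c m′ (ℕ.≤-pred c3<m)) (forced m′)

-- The periodic construction

OffMiddleLeft : ∀ {m} → Vertex 3 m → Set
OffMiddleLeft (i , j) = toℕ j ≡ 0 → i ≢ 1F

InBlock : ∀ {m} → Vertex 3 (4 + m) → Set
InBlock (i , j) = toℕ j < 4 × (suc (toℕ j) ≡ 4 → i ≡ 1F)

separated-across : ∀ {m} {a b : Vertex 3 (4 + m)} {c d : Vertex 3 m} →
  InBlock a → InBlock b → OffMiddleLeft c → OffMiddleLeft d → Separated (a , b) (shiftEdge 4 (c , d))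
separated-across ia ib oc od = apart ia oc , apart ia od , apart ib oc , apart ib od
  where
  apart : ∀ {x y} → InBlock x → OffMiddleLeft y → Apart x (shiftVertex 4 y)
  apart {x} {y} (j<4 , seam⇒middle) off =
    apart-across 4 x y j<4 λ seam first same-row → off first (trans (sym same-row) (seam⇒middle seam))

block : ∀ {m} → List (Edge 3 (4 + m))
block = ((0F , 0F) , (0F , 1F)) ∷ ((2F , 0F) , (2F , 1F)) ∷ ((1F , 2F) , (1F , 3F)) ∷ []

closing : List (Edge 3 5)
closing = ((0F , 0F) , (0F , 1F)) ∷ ((2F , 0F) , (2F , 1F)) ∷ ((0F , 3F) , (0F , 4F)) ∷ ((2F , 3F) , (2F , 4F)) ∷ []

periodic : ∀ k → List (Edge 3 (5 + k * 4))
periodic zero    = closing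
periodic (suc k) = block ++ map (shiftEdge 4) (periodic k)

periodic-length : ∀ k → length (periodic k) ≡ 4 + k * 3
periodic-length zero    = refl
periodic-length (suc k) = cong (3 +_) (trans (length-map (shiftEdge 4) (periodic k)) (periodic-length k))

periodic-offMiddleLeft : ∀ k → All (λ e → OffMiddleLeft (proj₁ e) × OffMiddleLeft (proj₂ e)) (periodic k)
periodic-offMiddleLeft zero =
  ((λ _ ()) , λ ()) ∷ ((λ _ ()) , λ ()) ∷ ((λ ()) , λ ()) ∷ ((λ ()) , λ ()) ∷ []
periodic-offMiddleLeft (suc k) =
  AllP.++⁺ (((λ _ ()) , λ ()) ∷ ((λ _ ()) , λ ()) ∷ ((λ ()) , λ ()) ∷ [])
           (AllP.map⁺ (All.universal (λ _ → (λ ()) , (λ ())) (periodic k)))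

periodic-edges : ∀ k → All IsGridEdge (periodic k)
periodic-edges zero    = from-yes (All.all? isGridEdge? closing)
periodic-edges (suc k) = AllP.++⁺ (from-yes (All.all? isGridEdge? block))
                                  (AllP.map⁺ (All.map (shift-adjacent⁺ 4) (periodic-edges k)))

periodic-separated : ∀ k → AllPairs Separated (periodic k)
periodic-separated zero    = from-yes (allPairs? separated? closing)
periodic-separated (suc k) =
  AllPairsP.++⁺ (from-yes (allPairs? separated? block))
                (AllPairsP.map⁺ (AllPairs.map (shift-separated 4) (periodic-separated k)))
                (across (z<s , λ ()) (s<s z<s , λ ()) ∷
                 across (z<s , λ ()) (s<s z<s , λ ()) ∷
                 across (s<s (s<s z<s) , λ ()) (s<s (s<s (s<s z<s)) , λ _ → refl) ∷ [])
  where
  across : ∀ {a b} → InBlock a → InBlock b → All (Separated (a , b)) (map (shiftEdge 4) (periodic k))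
  across ia ib = AllP.map⁺ (All.map (λ (oc , od) → separated-across ia ib oc od) (periodic-offMiddleLeft k))

periodic-induced : ∀ k → IsInducedMatching 3 (5 + k * 4) (periodic k)
periodic-induced k = separated⇒inducedMatching (periodic-edges k) (periodic-separated k)

periodic-exceeds : ∀ k → 3 * (5 + k * 4) < 4 * (4 + k * 3)
periodic-exceeds k = ℕ.≤-reflexive
  (solve 1 (λ k → con 1 :+ con 3 :* (con 5 :+ k :* con 4) := con 4 :* (con 4 :+ k :* con 3)) refl k)

%4≡1⇒≡5+k*4 : ∀ m → m % 4 ≡ 1 → 5 ≤ m → ∃[ k ] m ≡ 5 + k * 4
%4≡1⇒≡5+k*4 m m%4≡1 5≤m with m / 4 | trans (m≡m%n+[m/n]*n m 4) (cong (_+ m / 4 * 4) m%4≡1)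
... | zero  | m≡1 = ⊥-elim (ℕ.<⇒≱ (s≤s (s≤s z≤n)) (subst (5 ≤_) m≡1 5≤m))
... | suc k | m≡  = k , m≡

lemma3p5 : (m : ℕ) → m % 4 ≡ 1 → 5 ≤ m →
    (M : List (Edge 3 m)) → IsInducedMatching 3 m M →
    (c : ℕ) → (c<m : c < m) → (c3<m : c + 3 < m) →
    ContainsEdge M (zero , fromℕ< c<m) (suc zero , fromℕ< c<m) →
    ContainsEdge M (zero , fromℕ< c3<m) (suc zero , fromℕ< c3<m) →
    ¬ IsMaxInducedMatchingSize 3 m (length M)
lemma3p5 m m%4≡1 5≤m M isIM c c<m c3<m E₁ E₂ (_ , maximal) with %4≡1⇒≡5+k*4 m m%4≡1 5≤m
... | k , refl = ℕ.<⇒≱ (periodic-exceeds k) (begin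
  4 * (4 + k * 3)          ≡⟨ cong (4 *_) (periodic-length k) ⟨
  4 * length (periodic k)  ≤⟨ ℕ.*-monoʳ-≤ 4 (maximal (periodic k) (periodic-induced k)) ⟩
  4 * length M             ≤⟨ vertical-pair⇒4*length≤3*m M isIM c c<m c3<m E₁ E₂ ⟩
  3 * (5 + k * 4)          ∎)
  where open ℕ.≤-Reasoning
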